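{- Let $k$ be a positive integer and let $T$ be a tree. If $|F(T)|>k\,(M(T)+2)$, then $\mu_{\mathrm{int}}(\widetilde{T})>k$.
   Context: Graphs are finite and simple. A $k$-improper edge coloring of a graph $H$ is a map $\alpha:E(H)\to\mathbb{N}$ such that at most $k$ edges with a common endpoint receive the same color; it is an improper interval coloring if at every vertex the colors on incident edges form a set of consecutive integers. $\mu_{\mathrm{int}}(H)$ is the smallest $k$ such that $H$ has a $k$-improper interval edge coloring. For a tree $T$, $F(T)=\{v\in V(T): d_T(v)=1\}$ is its set of leaves, and, with $\mathcal{P}$ the set of all paths in $T$, $$M(T)=\max_{P\in\mathcal{P}}\Big(|E(P)|+\big|\{uw\in E(T): u\in V(P),\ w\notin V(P)\}\big|\Big).$$ The graph $\widetilde{T}$ is obtained from $T$ by adding a new vertex $u$ and the edges $uv$ for all $v\in F(T)$. -}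

module Defs where

open import Data.Nat using (ℕ; zero; suc; _+_; _*_; _∸_; _≤_; _<_; _≡ᵇ_)
open import Data.Bool using (Bool; true; false; _∧_; not; if_then_else_)
open import Data.Fin using (Fin; zero; suc; _≟_)
open import Data.List using (List; []; _∷_; _++_; [_]; length; map)
open import Data.Nat.ListAction using (sum)
open import Data.List.Relation.Unary.Unique.Propositional using (Unique)
open import Data.List.Relation.Unary.Linked using (Linked)
open import Data.Product using (Σ; ∃; _×_; _,_)
open import Relation.Nullary using (¬_)
open import Relation.Nullary.Decidable using (⌊_⌋)
open import Relation.Binary.PropositionalEquality using (_≡_; refl)

count : {n : ℕ} → (Fin n → Bool) → ℕ
count {zero} f = 0
count {suc n} f = (if f zero then 1 else 0) + count (λ i → f (suc i))

record Graph (n : ℕ) : Set where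
  field
    adj    : Fin n → Fin n → Bool
    adjSym : ∀ u v → adj u v ≡ adj v u
    irrefl : ∀ v → adj v v ≡ false

open Graph public

Adj : {n : ℕ} → Graph n → Fin n → Fin n → Set
Adj G u v = adj G u v ≡ true

degree : {n : ℕ} → Graph n → Fin n → ℕ
degree G v = count (adj G v)

isLeaf : {n : ℕ} → Graph n → Fin n → Bool
isLeaf G v = degree G v ≡ᵇ 1

numLeaves : {n : ℕ} → Graph n → ℕ
numLeaves G = count (isLeaf G)

data Walk {n : ℕ} (G : Graph n) : Fin n → Fin n → Set where
  here : ∀ {u} → Walk G u u
  step : ∀ {u v w} → Adj G u v → Walk G v w → Walk G u w

Connected : {n : ℕ} → Graph n → Set
Connected G = ∀ u v → Walk G u v

HasCycle : {n : ℕ} → Graph n → Set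
HasCycle {n} G = Σ (Fin n) λ x → Σ (List (Fin n)) λ xs →
  (2 ≤ length xs) × Unique (x ∷ xs) × Linked (Adj G) (x ∷ xs ++ [ x ])

IsTree : {n : ℕ} → Graph n → Set
IsTree {n} G = (1 ≤ n) × Connected G × ¬ HasCycle G

IsPath : {n : ℕ} → Graph n → List (Fin n) → Set
IsPath G xs = (1 ≤ length xs) × Unique xs × Linked (Adj G) xs

_∈ᵇ_ : {n : ℕ} → Fin n → List (Fin n) → Bool
x ∈ᵇ [] = false
x ∈ᵇ (y ∷ ys) = if ⌊ x ≟ y ⌋ then true else x ∈ᵇ ys

-- |E(P)| + |{uw ∈ E(T) : u ∈ V(P), w ∉ V(P)}|
pathValue : {n : ℕ} → Graph n → List (Fin n) → ℕ
pathValue G xs = (length xs ∸ 1)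
  + sum (map (λ u → count (λ w → adj G u w ∧ not (w ∈ᵇ xs))) xs)

IsM : {n : ℕ} → Graph n → ℕ → Set
IsM {n} G m = (Σ (List (Fin n)) λ P → IsPath G P × pathValue G P ≡ m)
            × (∀ (P : List (Fin n)) → IsPath G P → pathValue G P ≤ m)

-- T̃ : new vertex zero, old vertex v becomes suc v; zero adjacent to all leaves
tildeAdj : {n : ℕ} → Graph n → Fin (suc n) → Fin (suc n) → Bool
tildeAdj G zero zero = false
tildeAdj G zero (suc v) = isLeaf G v
tildeAdj G (suc v) zero = isLeaf G v
tildeAdj G (suc u) (suc v) = adj G u v

tildeSym : {n : ℕ} (G : Graph n) → ∀ u v → tildeAdj G u v ≡ tildeAdj G v u
tildeSym G zero zero = refl
tildeSym G zero (suc v) = refl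
tildeSym G (suc u) zero = refl
tildeSym G (suc u) (suc v) = adjSym G u v

tildeIrrefl : {n : ℕ} (G : Graph n) → ∀ v → tildeAdj G v v ≡ false
tildeIrrefl G zero = refl
tildeIrrefl G (suc v) = irrefl G v

tilde : {n : ℕ} → Graph n → Graph (suc n)
tilde G = record { adj = tildeAdj G ; adjSym = tildeSym G ; irrefl = tildeIrrefl G }

-- An edge colouring: colour c u v of edge uv (only values on edges matter), symmetric on edges
IsEdgeColouring : {n : ℕ} → Graph n → (Fin n → Fin n → ℕ) → Set
IsEdgeColouring G c = ∀ u v → Adj G u v → c u v ≡ c v u

KImproper : {n : ℕ} → Graph n → ℕ → (Fin n → Fin n → ℕ) → Set
KImproper G k c = ∀ v i → count (λ w → adj G v w ∧ (c v w ≡ᵇ i)) ≤ k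

IsInterval : {n : ℕ} → Graph n → (Fin n → Fin n → ℕ) → Set
IsInterval {n} G c = ∀ v w₁ w₂ i → Adj G v w₁ → Adj G v w₂ →
  c v w₁ ≤ i → i ≤ c v w₂ → Σ (Fin n) λ w → Adj G v w × c v w ≡ i

HasImproperInterval : {n : ℕ} → Graph n → ℕ → Set
HasImproperInterval {n} G k = Σ (Fin n → Fin n → ℕ) λ c →
  IsEdgeColouring G c × KImproper G k c × IsInterval G c

-- μ_int(G) > k  (μ_int is the least j admitting a j-improper interval colouring)
MuIntGreaterThan : {n : ℕ} → Graph n → ℕ → Set
MuIntGreaterThan G k = ∀ j → j ≤ k → ¬ HasImproperInterval G j

-- Let c be a j-improper interval colouring of T̃ with j ≤ k, and u the new vertex.
-- At a vertex x the colours form an interval of at most deg x values, so along an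
-- induced path a = x₀, …, x_r = b between leaves, going from the edge ua to the edge ub,
-- each x_i raises the colour by at most deg_T̃ x_i − 1, which is at most 1 + (edges leaving
-- the path at x_i) because x_i has at most two neighbours on an induced path.
-- Hence c(ub) ≤ c(ua) + 1 + (value of the path) ≤ c(ua) + M(T) + 1: the colours at u
-- take at most M(T) + 2 values, each on at most k edges, so |F(T)| = deg u ≤ k (M(T) + 2).

module Submission where

open import Defs
open import Data.Bool using (Bool; true; false; _∧_; not)
import Data.Bool as Bool
open import Data.Bool.Properties using (∧-conicalˡ; ∧-conicalʳ)
open import Data.Fin using (Fin; zero; suc; _≟_)
import Data.Fin.Properties as Finₚ
open import Data.List using (List; []; _∷_; length; map; filter; drop; allFin)
open import Data.List.Extrema.Nat using (argmin; argmin-all; f[argmin]≤v⁺)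
open import Data.List.Membership.Propositional using (_∈_; lose)
open import Data.List.Membership.Propositional.Properties using (∈-filter⁺; ∈-allFin)
open import Data.List.Properties using (length-map; map-∘; filter-none)
open import Data.List.Relation.Unary.All as All using (All; []; _∷_)
open import Data.List.Relation.Unary.All.Properties using (all-filter; ¬Any⇒All¬; map⁺)
open import Data.List.Relation.Unary.AllPairs using ([]; _∷_)
open import Data.List.Relation.Unary.Any using (Any; here; there; any?)
open import Data.List.Relation.Unary.Linked using (Linked; [-]; _∷_)
open import Data.List.Relation.Unary.Unique.Propositional using (Unique)
open import Data.Nat using (ℕ; zero; suc; _+_; _*_; _∸_; _≤_; _<_; _≡ᵇ_; z≤n; s≤s; _≤?_)
open import Data.Nat.ListAction using (sum)
open import Data.Nat.Properties renaming (_≟_ to _≟ℕ_)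
open import Data.Nat.Tactic.RingSolver using (solve-∀)
open import Data.Product using (∃; Σ; _×_; _,_)
open import Data.Sum using (_⊎_; inj₁; inj₂)
open import Data.Unit using (⊤; tt)
open import Function using (_∘_)
open import Relation.Nullary using (Dec; yes; no; ¬_; contradiction)
open import Relation.Nullary.Decidable using (does; dec-true; dec-false; _⊎-dec_)
open import Relation.Binary.PropositionalEquality

does-true : ∀ {A : Set} (d : Dec A) → does d ≡ true → A
does-true (yes a) _ = a

does-false : ∀ {A : Set} (d : Dec A) → not (does d) ≡ true → ¬ A
does-false (no ¬a) _ = ¬a

not-does : ∀ {A : Set} (d : Dec A) → ¬ A → not (does d) ≡ true
not-does d ¬a = cong not (dec-false d ¬a)

count-none : ∀ {n} (f : Fin n → Bool) → (∀ x → f x ≢ true) → count f ≡ 0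
count-none {zero}  f none = refl
count-none {suc n} f none with f zero in e
... | true  = contradiction e (none zero)
... | false = count-none (f ∘ suc) (none ∘ suc)

count-pos : ∀ {n} (f : Fin n → Bool) (x : Fin n) → f x ≡ true → 1 ≤ count f
count-pos f zero    e rewrite e = s≤s z≤n
count-pos f (suc x) e with f zero
... | true  = s≤s z≤n
... | false = count-pos (f ∘ suc) x e

count-witness : ∀ {n} (f : Fin n → Bool) → 1 ≤ count f → ∃ λ x → f x ≡ true
count-witness {suc n} f pos with f zero in e
... | true  = zero , e
... | false with x , fx ← count-witness (f ∘ suc) pos = suc x , fx

count-mono : ∀ {n} (f g : Fin n → Bool) → (∀ x → f x ≡ true → g x ≡ true) → count f ≤ count g
count-mono {zero}  f g f⇒g = z≤n
count-mono {suc n} f g f⇒g with f zero in ef | g zero in eg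
... | false | false = count-mono (f ∘ suc) (g ∘ suc) (f⇒g ∘ suc)
... | false | true  = m≤n⇒m≤1+n (count-mono (f ∘ suc) (g ∘ suc) (f⇒g ∘ suc))
... | true  | true  = s≤s (count-mono (f ∘ suc) (g ∘ suc) (f⇒g ∘ suc))
... | true  | false = contradiction (trans (sym eg) (f⇒g zero ef)) λ ()

count-split : ∀ {n} (f h : Fin n → Bool) →
  count f ≡ count (λ x → f x ∧ h x) + count (λ x → f x ∧ not (h x))
count-split {zero}  f h = refl
count-split {suc n} f h with f zero | h zero
... | false | _     = count-split (f ∘ suc) (h ∘ suc)
... | true  | true  = cong suc (count-split (f ∘ suc) (h ∘ suc))
... | true  | false = trans (cong suc (count-split (f ∘ suc) (h ∘ suc))) (sym (+-suc _ _))

count-≤1 : ∀ {n} (f : Fin n → Bool) (a : Fin n) → (∀ x → f x ≡ true → x ≡ a) → count f ≤ 1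
count-≤1 {suc n} f zero only
  rewrite count-none (f ∘ suc) (λ x e → Finₚ.0≢1+n (sym (only (suc x) e))) with f zero
... | true  = ≤-refl
... | false = z≤n
count-≤1 {suc n} f (suc a) only with f zero in e
... | true  = contradiction (only zero e) (Finₚ.0≢1+n)
... | false = count-≤1 (f ∘ suc) a λ x fx → Finₚ.suc-injective (only (suc x) fx)

count-≤-length : ∀ {n} (f : Fin n → Bool) (xs : List (Fin n)) →
  (∀ x → f x ≡ true → x ∈ xs) → count f ≤ length xs
count-≤-length f [] inside = ≤-reflexive (count-none f λ x fx → contradiction (inside x fx) λ ())
count-≤-length f (y ∷ ys) inside = begin
  count f                                                          ≡⟨ count-split f is-y ⟩
  count (λ x → f x ∧ is-y x) + count (λ x → f x ∧ not (is-y x))  ≤⟨ +-mono-≤ at-most-y in-ys≤ ⟩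
  suc (length ys)                                                  ∎
  where
  open ≤-Reasoning
  is-y : Fin _ → Bool
  is-y x = does (x ≟ y)
  at-y : ∀ x → f x ∧ is-y x ≡ true → x ≡ y
  at-y x e = does-true (x ≟ y) (∧-conicalʳ _ _ e)
  in-ys : ∀ x → f x ∧ not (is-y x) ≡ true → x ∈ ys
  in-ys x e with inside x (∧-conicalˡ _ _ e)
  ... | here x≡y = contradiction x≡y (does-false (x ≟ y) (∧-conicalʳ _ _ e))
  ... | there x∈ys = x∈ys
  at-most-y : count (λ x → f x ∧ is-y x) ≤ 1
  at-most-y = count-≤1 _ y at-y
  in-ys≤ : count (λ x → f x ∧ not (is-y x)) ≤ length ys
  in-ys≤ = count-≤-length _ ys in-ys

∈ᵇ⇒∈ : ∀ {n} {x : Fin n} (xs : List (Fin n)) → x ∈ᵇ xs ≡ true → x ∈ xs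
∈ᵇ⇒∈ {x = x} (y ∷ ys) e with x ≟ y
... | yes x≡y = here x≡y
... | no  _   = there (∈ᵇ⇒∈ ys e)

count-≤-width*fibre : ∀ {n} (k len lo : ℕ) (f : Fin n → Bool) (g : Fin n → ℕ) →
  (∀ i → count (λ x → f x ∧ (g x ≡ᵇ i)) ≤ k) →
  (∀ x → f x ≡ true → lo ≤ g x × g x < lo + len) → count f ≤ len * k
count-≤-width*fibre k zero lo f g fibre range =
  ≤-reflexive (count-none f λ x fx → let (lo≤ , <lo+0) = range x fx in
    <-irrefl refl (<-≤-trans (subst (g x <_) (+-identityʳ lo) <lo+0) lo≤))
count-≤-width*fibre k (suc len) lo f g fibre range = begin
  count f                                             ≡⟨ count-split f (λ x → g x ≡ᵇ lo) ⟩
  count (λ x → f x ∧ (g x ≡ᵇ lo)) + count f-above  ≤⟨ +-mono-≤ (fibre lo) above ⟩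
  k + len * k                                         ∎
  where
  open ≤-Reasoning
  f-above : Fin _ → Bool
  f-above x = f x ∧ not (g x ≡ᵇ lo)
  fibre-above : ∀ i → count (λ x → f-above x ∧ (g x ≡ᵇ i)) ≤ k
  fibre-above i = ≤-trans (count-mono _ _ shrink) (fibre i)
    where
    shrink : ∀ x → f-above x ∧ (g x ≡ᵇ i) ≡ true → f x ∧ (g x ≡ᵇ i) ≡ true
    shrink x e =
      cong₂ _∧_ (∧-conicalˡ (f x) _ (∧-conicalˡ (f-above x) _ e)) (∧-conicalʳ (f-above x) _ e)
  range-above : ∀ x → f-above x ≡ true → suc lo ≤ g x × g x < suc lo + len
  range-above x e = let (lo≤ , <lo+) = range x (∧-conicalˡ _ _ e) in
    ≤∧≢⇒< lo≤ (does-false (g x ≟ℕ lo) (∧-conicalʳ _ _ e) ∘ sym) , subst (g x <_) (+-suc lo len) <lo+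
  above : count f-above ≤ len * k
  above = count-≤-width*fibre k len (suc lo) f-above g fibre-above range-above

width-≤-count : ∀ {n} (len lo : ℕ) (f : Fin n → Bool) (g : Fin n → ℕ) →
  (∀ i → lo ≤ i → i < lo + len → ∃ λ x → f x ≡ true × g x ≡ i) → len ≤ count f
width-≤-count zero      lo f g hit = z≤n
width-≤-count (suc len) lo f g hit
  with x₀ , fx₀ , gx₀ ← hit lo ≤-refl (m<m+n lo (s≤s z≤n)) = begin
  suc len                                             ≤⟨ +-mono-≤ at-lo above ⟩
  count (λ x → f x ∧ (g x ≡ᵇ lo)) + count f-above  ≡⟨ count-split f (λ x → g x ≡ᵇ lo) ⟨
  count f                                             ∎
  where
  open ≤-Reasoning
  f-above : Fin _ → Bool
  f-above x = f x ∧ not (g x ≡ᵇ lo)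
  hit-above : ∀ i → suc lo ≤ i → i < suc lo + len → ∃ λ x → f-above x ≡ true × g x ≡ i
  hit-above i lo<i i< with hit i (<⇒≤ lo<i) (subst (i <_) (sym (+-suc lo len)) i<)
  ... | x , fx , gx≡i =
    x , cong₂ _∧_ fx (not-does (g x ≟ℕ lo) λ gx≡lo → <-irrefl (trans (sym gx≡lo) gx≡i) lo<i) , gx≡i
  at-lo : 1 ≤ count (λ x → f x ∧ (g x ≡ᵇ lo))
  at-lo = count-pos _ x₀ (cong₂ _∧_ fx₀ (dec-true (g x₀ ≟ℕ lo) gx₀))
  above : len ≤ count f-above
  above = width-≤-count len (suc lo) f-above g hit-above

∃-minimum : ∀ {n} (f : Fin n → Bool) (g : Fin n → ℕ) → ∃ (λ x → f x ≡ true) →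
  ∃ λ a → f a ≡ true × (∀ x → f x ≡ true → g a ≤ g x)
∃-minimum {n} f g (x₀ , fx₀) =
  argmin g x₀ candidates ,
  argmin-all g fx₀ (all-filter f? (allFin n)) ,
  λ x fx → f[argmin]≤v⁺ x₀ candidates (inj₂ (lose (∈-filter⁺ f? (∈-allFin x) fx) ≤-refl))
  where
  f? : ∀ x → Dec (f x ≡ true)
  f? x = f x Bool.≟ true
  candidates : List (Fin n)
  candidates = filter f? (allFin n)

module _ {n : ℕ} (G : Graph n) where

  vertices : ∀ {u v} → Walk G u v → List (Fin n)
  vertices {u} here       = u ∷ []
  vertices {u} (step _ w) = u ∷ vertices w

  start∈vertices : ∀ {u v} (w : Walk G u v) → u ∈ vertices w
  start∈vertices here       = here refl
  start∈vertices (step _ _) = here refl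

  length-vertices : ∀ {u v} (w : Walk G u v) → length (vertices w) ≡ suc (length (vertices w) ∸ 1)
  length-vertices here       = refl
  length-vertices (step _ _) = refl

  vertices-linked : ∀ {u v} (w : Walk G u v) → Linked (Adj G) (vertices w)
  vertices-linked here                 = [-]
  vertices-linked (step e here)        = e ∷ [-]
  vertices-linked (step e (step e′ w)) = e ∷ vertices-linked (step e′ w)

module _ {n : ℕ} (G : Graph n) (c : Fin n → Fin n → ℕ) (interval : IsInterval G c) where

  interval-spread : ∀ {v w₁ w₂} → Adj G v w₁ → Adj G v w₂ → c v w₂ < c v w₁ + degree G v
  interval-spread {v} {w₁} {w₂} a₁ a₂ with c v w₁ ≤? c v w₂
  ... | no  w₁≰w₂ = <-≤-trans (≰⇒> w₁≰w₂) (m≤m+n _ _)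
  ... | yes w₁≤w₂ = begin-strict
    c v w₂                        ≡⟨ m+[n∸m]≡n w₁≤w₂ ⟨
    c v w₁ + (c v w₂ ∸ c v w₁)    <⟨ +-monoʳ-< (c v w₁) (width-≤-count _ _ (adj G v) (c v) hit) ⟩
    c v w₁ + degree G v           ∎
    where
    open ≤-Reasoning
    hit : ∀ i → c v w₁ ≤ i → i < c v w₁ + suc (c v w₂ ∸ c v w₁) → ∃ λ w → Adj G v w × c v w ≡ i
    hit i w₁≤i i< = interval v w₁ w₂ i a₁ a₂ w₁≤i
      (≤-pred (subst (i <_) (trans (+-suc _ _) (cong suc (m+[n∸m]≡n w₁≤w₂))) i<))

  interval-step : ∀ {v w₁ w₂} (b : ℕ) → Adj G v w₁ → Adj G v w₂ → degree G v ≤ 2 + b →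
    c v w₂ ≤ c v w₁ + suc b
  interval-step {v} {w₁} {w₂} b a₁ a₂ deg≤ = ≤-pred (begin-strict
    c v w₂                 <⟨ interval-spread a₁ a₂ ⟩
    c v w₁ + degree G v    ≤⟨ +-monoʳ-≤ (c v w₁) deg≤ ⟩
    c v w₁ + suc (suc b)   ≡⟨ +-suc (c v w₁) (suc b) ⟩
    suc (c v w₁ + suc b)   ∎)
    where open ≤-Reasoning

  interval-drift : IsEdgeColouring G c → (β : Fin n → ℕ) → ∀ {x y p q} (w : Walk G x y) →
    All (λ z → degree G z ≤ 2 + β z) (vertices G w) → Adj G x p → Adj G y q →
    c y q ≤ c x p + (length (vertices G w) + sum (map β (vertices G w)))
  interval-drift colouring β {x} {p = p} {q} here (deg ∷ []) ap aq =
    subst (λ s → c x q ≤ c x p + suc s) (sym (+-identityʳ (β x))) (interval-step (β x) ap aq deg)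
  interval-drift colouring β {x} {y} {p} {q} (step {v = x′} e w) (deg ∷ degs) ap aq = begin
    c y q                                 ≤⟨ interval-drift colouring β w degs e′ aq ⟩
    c x′ x + (L + S)                      ≡⟨ cong (_+ (L + S)) (colouring x′ x e′) ⟩
    c x x′ + (L + S)                      ≤⟨ +-monoˡ-≤ (L + S) (interval-step (β x) ap e deg) ⟩
    c x p + suc (β x) + (L + S)           ≡⟨ regroup (c x p) (β x) L S ⟩
    c x p + (suc L + (β x + S))           ∎
    where
    open ≤-Reasoning
    L S : ℕ
    L = length (vertices G w)
    S = sum (map β (vertices G w))
    e′ : Adj G x′ x
    e′ = trans (adjSym G x′ x) e
    regroup : ∀ a b l s → a + suc b + (l + s) ≡ a + (suc l + (b + s))
    regroup = solve-∀

module _ {n : ℕ} (G : Graph n) where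

  Chordless : List (Fin n) → Set
  Chordless []       = ⊤
  Chordless (x ∷ xs) = All (λ y → ¬ Adj G x y) (drop 1 xs) × Chordless xs

  IsInducedPath : ∀ {u v} → Walk G u v → Set
  IsInducedPath w = Unique (vertices G w) × Chordless (vertices G w)

  Near : Fin n → Fin n → Set
  Near x y = x ≡ y ⊎ Adj G x y

  adjacent? : ∀ x y → Dec (Adj G x y)
  adjacent? x y = adj G x y Bool.≟ true

  near? : ∀ x y → Dec (Near x y)
  near? x y = (x ≟ y) ⊎-dec adjacent? x y

  adjacent⇒≢ : ∀ {x y} → Adj G x y → x ≢ y
  adjacent⇒≢ {x} e refl = contradiction (trans (sym (irrefl G x)) e) λ ()

  induced-tail : ∀ {u v w} {e : Adj G u v} {Q : Walk G v w} →
    IsInducedPath (step e Q) → IsInducedPath Q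
  induced-tail (_ ∷ unique , _ , chordless) = unique , chordless

  induced-step : ∀ {x y v} (e : Adj G x y) (Q : Walk G y v) →
    All (λ z → ¬ Near x z) (drop 1 (vertices G Q)) → IsInducedPath Q → IsInducedPath (step e Q)
  induced-step e here       []  (unique , chordless) =
    (adjacent⇒≢ e ∷ []) ∷ unique , [] , chordless
  induced-step e (step _ Q) far (unique , chordless) =
    (adjacent⇒≢ e ∷ All.map (_∘ inj₁) far) ∷ unique , All.map (_∘ inj₂) far , chordless

  -- The walk from x joins Q at the last vertex of Q that is equal or adjacent to x.
  attach : ∀ x {y v} (Q : Walk G y v) → IsInducedPath Q → Any (Near x) (vertices G Q) →
    Σ (Walk G x v) IsInducedPath
  attach x here       induced (here (inj₁ refl)) = here , induced
  attach x here       induced (here (inj₂ e))    = step e here , induced-step e here [] induced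
  attach x (step e Q) induced near with any? (near? x) (vertices G Q)
  ... | yes near-Q = attach x Q (induced-tail {e = e} induced) near-Q
  ... | no far with near
  ...   | here (inj₁ refl) = step e Q , induced
  ...   | here (inj₂ e′)   =
    step e′ (step e Q) , induced-step e′ (step e Q) (¬Any⇒All¬ _ far) induced
  ...   | there near-Q     = contradiction near-Q far

  inducedPath : ∀ {u v} → Walk G u v → Σ (Walk G u v) IsInducedPath
  inducedPath here = here , [] ∷ [] , [] , tt
  inducedPath {u} (step e w) with Q , induced ← inducedPath w =
    attach u Q induced (lose (start∈vertices G Q) (inj₂ e))

  neighboursIn : Fin n → List (Fin n) → List (Fin n)
  neighboursIn x = filter (adjacent? x)

  chordless-head-neighbours : ∀ x xs → Chordless (x ∷ xs) → length (neighboursIn x (x ∷ xs)) ≤ 1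
  chordless-head-neighbours x []       _         rewrite irrefl G x = z≤n
  chordless-head-neighbours x (y ∷ ys) (far , _) rewrite irrefl G x with adjacent? x y
  ... | yes _ rewrite filter-none (adjacent? x) far = ≤-refl
  ... | no  _ rewrite filter-none (adjacent? x) far = z≤n

  chordless-second-neighbours : ∀ {x} y ys → Chordless (y ∷ ys) → x ∈ ys → Adj G x y →
    length (neighboursIn x ys) ≤ 1
  chordless-second-neighbours y (z ∷ zs) (_ , chordless) (here refl) _ =
    chordless-head-neighbours z zs chordless
  chordless-second-neighbours y (z ∷ zs) (far , _) (there x∈zs) x~y =
    contradiction (trans (adjSym G y _) x~y) (All.lookup far x∈zs)

  chordless-neighbours : ∀ {x} xs → Chordless xs → x ∈ xs → length (neighboursIn x xs) ≤ 2
  chordless-neighbours (y ∷ ys) chordless (here refl) =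
    m≤n⇒m≤1+n (chordless-head-neighbours y ys chordless)
  chordless-neighbours {x} (y ∷ ys) chordless@(_ , chordless-ys) (there x∈ys) with adjacent? x y
  ... | yes x~y = s≤s (chordless-second-neighbours y ys chordless x∈ys x~y)
  ... | no  _   = chordless-neighbours ys chordless-ys x∈ys

  exits : List (Fin n) → Fin n → ℕ
  exits xs u = count (λ w → adj G u w ∧ not (w ∈ᵇ xs))

  degree-≤-2+exits : ∀ {x} xs → Chordless xs → x ∈ xs → degree G x ≤ 2 + exits xs x
  degree-≤-2+exits {x} xs chordless x∈xs = begin
    degree G x                                             ≡⟨ count-split (adj G x) (_∈ᵇ xs) ⟩
    count (λ w → adj G x w ∧ (w ∈ᵇ xs)) + exits xs x    ≤⟨ +-monoˡ-≤ (exits xs x) neighbours≤2 ⟩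
    2 + exits xs x                                         ∎
    where
    open ≤-Reasoning
    inside : ∀ w → adj G x w ∧ (w ∈ᵇ xs) ≡ true → w ∈ neighboursIn x xs
    inside w e = ∈-filter⁺ (adjacent? x) (∈ᵇ⇒∈ xs (∧-conicalʳ _ _ e)) (∧-conicalˡ _ _ e)
    neighbours≤2 : count (λ w → adj G x w ∧ (w ∈ᵇ xs)) ≤ 2
    neighbours≤2 = ≤-trans (count-≤-length _ (neighboursIn x xs) inside)
                           (chordless-neighbours xs chordless x∈xs)

module _ {n : ℕ} (T : Graph n) where

  liftWalk : ∀ {u v} → Walk T u v → Walk (tilde T) (suc u) (suc v)
  liftWalk here       = here
  liftWalk (step e w) = step e (liftWalk w)

  vertices-liftWalk : ∀ {u v} (w : Walk T u v) →
    vertices (tilde T) (liftWalk w) ≡ map suc (vertices T w)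
  vertices-liftWalk here       = refl
  vertices-liftWalk (step _ w) = cong (suc _ ∷_) (vertices-liftWalk w)

  tilde-degree-≤ : ∀ {x b} → degree T x ≤ 2 + b → degree (tilde T) (suc x) ≤ 2 + b
  tilde-degree-≤ {x} {b} deg≤ with isLeaf T x in leaf
  ... | true  = subst (λ d → suc d ≤ 2 + b) (sym (does-true (degree T x ≟ℕ 1) leaf)) (s≤s (s≤s z≤n))
  ... | false = deg≤

module _ {n : ℕ} (T : Graph n) (c : Fin (suc n) → Fin (suc n) → ℕ)
  (colouring : IsEdgeColouring (tilde T) c) (interval : IsInterval (tilde T) c) where

  leaf-colours-close : Connected T → ∀ {m} → (∀ P → IsPath T P → pathValue T P ≤ m) →
    ∀ {a b} → isLeaf T a ≡ true → isLeaf T b ≡ true → c zero (suc b) < c zero (suc a) + (m + 2)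
  leaf-colours-close connected {m} bounded {a} {b} leaf-a leaf-b
    with Q , unique , chordless ← inducedPath T (connected a b) = begin-strict
    c zero (suc b)                                  ≡⟨ colouring zero (suc b) leaf-b ⟩
    c (suc b) zero                                  ≤⟨ drift ⟩
    c (suc a) zero + (length P̃ + sum (map β P̃))   ≡⟨ cong₂ _+_ (colouring _ _ leaf-a) lifted-value ⟩
    c zero (suc a) + suc (pathValue T P)            ≤⟨ +-monoʳ-≤ _ (s≤s (bounded P path)) ⟩
    c zero (suc a) + suc m                          <⟨ +-monoʳ-< _ (≤-reflexive (+-comm 2 m)) ⟩
    c zero (suc a) + (m + 2)                        ∎
    where
    open ≤-Reasoning
    P : List (Fin n)
    P = vertices T Q
    P̃ : List (Fin (suc n))
    P̃ = vertices (tilde T) (liftWalk T Q)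
    -- β zero is irrelevant: the lifted walk never visits the new vertex.
    β : Fin (suc n) → ℕ
    β zero    = 0
    β (suc x) = exits T P x
    path : IsPath T P
    path = subst (1 ≤_) (sym (length-vertices T Q)) (s≤s z≤n) , unique , vertices-linked T Q
    degrees : All (λ z → degree (tilde T) z ≤ 2 + β z) P̃
    degrees = subst (All _) (sym (vertices-liftWalk T Q))
      (map⁺ (All.tabulate λ x∈P → tilde-degree-≤ T (degree-≤-2+exits T P chordless x∈P)))
    drift : c (suc b) zero ≤ c (suc a) zero + (length P̃ + sum (map β P̃))
    drift = interval-drift (tilde T) c interval colouring β (liftWalk T Q) degrees leaf-a leaf-b
    lifted-value : length P̃ + sum (map β P̃) ≡ suc (pathValue T P)
    lifted-value = trans (cong (λ xs → length xs + sum (map β xs)) (vertices-liftWalk T Q))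
      (cong₂ _+_ (trans (length-map suc P) (length-vertices T Q)) (cong sum (sym (map-∘ P))))

theorem13 : (k : ℕ) → 1 ≤ k → (n : ℕ) → (T : Graph n) → IsTree T →
    (m : ℕ) → IsM T m → k * (m + 2) < numLeaves T → MuIntGreaterThan (tilde T) k
theorem13 k _ n T (_ , connected , _) m (_ , bounded) many j j≤k
          (c , colouring , improper , interval)
  with a , leaf-a , minimal ← ∃-minimum (isLeaf T) (c zero ∘ suc)
                                 (count-witness (isLeaf T) (≤-trans (s≤s z≤n) many)) =
  <⇒≱ many (begin
    numLeaves T    ≤⟨ count-≤-width*fibre j (m + 2) _ (isLeaf T) (c zero ∘ suc) (improper zero) within ⟩
    (m + 2) * j    ≤⟨ *-monoʳ-≤ (m + 2) j≤k ⟩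
    (m + 2) * k    ≡⟨ *-comm (m + 2) k ⟩
    k * (m + 2)    ∎)
  where
  open ≤-Reasoning
  within : ∀ x → isLeaf T x ≡ true →
    c zero (suc a) ≤ c zero (suc x) × c zero (suc x) < c zero (suc a) + (m + 2)
  within x leaf-x =
    minimal x leaf-x , leaf-colours-close T c colouring interval connected bounded leaf-a leaf-x
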